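{- Let $S$ be a Kleene relation algebra satisfying the Tarski rule and let $x, y, z \in S$. If $x$ is a mapping, $y$ is a vector and $z$ is bijective, then $(y \sqcap z^T) \sqcup (\overline{y} \sqcap x)$ is a mapping.
   Context: A Kleene relation algebra is a structure $(S,\sqcup,\sqcap,\cdot,\overline{\phantom{x}},{}^T,{}^*,\bot,\top,1)$ such that $(S,\sqcup,\sqcap,\overline{\phantom{x}},\bot,\top)$ is a Boolean algebra with order $x \sqsubseteq y \iff x \sqcup y = y$; $(S,\sqcup,\cdot,\bot,1)$ is an idempotent semiring ($\cdot$ associative with two-sided unit $1$, distributing over $\sqcup$, $\bot$ a two-sided zero of $\cdot$); transposition satisfies $(x\sqcup y)^T = x^T \sqcup y^T$, $(x^T)^T = x$, $(x\cdot y)^T = y^T\cdot x^T$ and $(x\cdot y)\sqcap z \sqsubseteq x\cdot(y\sqcap(x^T\cdot z))$; and the star satisfies $1\sqcup y\cdot y^* = y^* = 1 \sqcup y^*\cdot y$, $z\sqcup y\cdot x\sqsubseteq x \Rightarrow y^*\cdot z\sqsubseteq x$, $z \sqcup x\cdot y \sqsubseteq x \Rightarrow z\cdot y^*\sqsubseteq x$. The Tarski rule states $\top\cdot x\cdot\top = \top$ for every $x \neq \bot$. An element $x$ is univalent if $x^T\cdot x\sqsubseteq 1$, total if $1 \sqsubseteq x\cdot x^T$, a mapping if univalent and total, injective if $x\cdot x^T\sqsubseteq 1$, surjective if $1\sqsubseteq x^T\cdot x$, bijective if injective and surjective, and a vector if $x\cdot\top = x$. The expression $(y \sqcap z^T)\sqcup(\overline{y}\sqcap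 x)$ is the array update of $x$ at index $y$ to value $z$. -}

module Defs where

open import Level using (Level; suc)
open import Relation.Binary.PropositionalEquality using (_≡_)
open import Relation.Nullary using (¬_)

record KleeneRelationAlgebra (a : Level) : Set (suc a) where
  infixr 6 _⊔_
  infixr 7 _⊓_
  infixr 8 _·_
  infix 4 _⊑_
  field
    S    : Set a
    _⊔_  : S → S → S
    _⊓_  : S → S → S
    _·_  : S → S → S
    ‾_   : S → S
    _ᵀ   : S → S
    _*   : S → S
    ⊥ᵣ   : S
    ⊤ᵣ   : S
    𝟙    : S

  _⊑_ : S → S → Set a
  x ⊑ y = x ⊔ y ≡ y

  field
    ⊔-assoc  : ∀ x y z → (x ⊔ y) ⊔ z ≡ x ⊔ (y ⊔ z)
    ⊔-comm   : ∀ x y → x ⊔ y ≡ y ⊔ x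
    ⊓-assoc  : ∀ x y z → (x ⊓ y) ⊓ z ≡ x ⊓ (y ⊓ z)
    ⊓-comm   : ∀ x y → x ⊓ y ≡ y ⊓ x
    ⊔-absorb : ∀ x y → x ⊔ (x ⊓ y) ≡ x
    ⊓-absorb : ∀ x y → x ⊓ (x ⊔ y) ≡ x
    ⊓-distrib-⊔ : ∀ x y z → x ⊓ (y ⊔ z) ≡ (x ⊓ y) ⊔ (x ⊓ z)
    ⊔-identity : ∀ x → x ⊔ ⊥ᵣ ≡ x
    ⊓-identity : ∀ x → x ⊓ ⊤ᵣ ≡ x
    compl-⊔  : ∀ x → x ⊔ (‾ x) ≡ ⊤ᵣ
    compl-⊓  : ∀ x → x ⊓ (‾ x) ≡ ⊥ᵣ
    ⊔-idem   : ∀ x → x ⊔ x ≡ x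
    ·-assoc  : ∀ x y z → (x · y) · z ≡ x · (y · z)
    ·-identityˡ : ∀ x → 𝟙 · x ≡ x
    ·-identityʳ : ∀ x → x · 𝟙 ≡ x
    ·-distribˡ : ∀ x y z → x · (y ⊔ z) ≡ (x · y) ⊔ (x · z)
    ·-distribʳ : ∀ x y z → (y ⊔ z) · x ≡ (y · x) ⊔ (z · x)
    ·-zeroˡ  : ∀ x → ⊥ᵣ · x ≡ ⊥ᵣ
    ·-zeroʳ  : ∀ x → x · ⊥ᵣ ≡ ⊥ᵣ
    ᵀ-⊔      : ∀ x y → (x ⊔ y) ᵀ ≡ (x ᵀ) ⊔ (y ᵀ)
    ᵀ-invol  : ∀ x → (x ᵀ) ᵀ ≡ x
    ᵀ-·      : ∀ x y → (x · y) ᵀ ≡ (y ᵀ) · (x ᵀ)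
    dedekind : ∀ x y z → (x · y) ⊓ z ⊑ x · (y ⊓ ((x ᵀ) · z))
    star-unfoldˡ : ∀ y → 𝟙 ⊔ (y · (y *)) ≡ y *
    star-unfoldʳ : ∀ y → 𝟙 ⊔ ((y *) · y) ≡ y *
    star-inductˡ : ∀ x y z → z ⊔ (y · x) ⊑ x → (y *) · z ⊑ x
    star-inductʳ : ∀ x y z → z ⊔ (x · y) ⊑ x → z · (y *) ⊑ x

  TarskiRule : Set a
  TarskiRule = ∀ x → ¬ (x ≡ ⊥ᵣ) → (⊤ᵣ · x) · ⊤ᵣ ≡ ⊤ᵣ

  univalent : S → Set a
  univalent x = (x ᵀ) · x ⊑ 𝟙

  total : S → Set a
  total x = 𝟙 ⊑ x · (x ᵀ)

  mapping : S → Set a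
  mapping x = univalent x × total x
    where open import Data.Product using (_×_)

  injective : S → Set a
  injective x = x · (x ᵀ) ⊑ 𝟙

  surjective : S → Set a
  surjective x = 𝟙 ⊑ (x ᵀ) · x

  bijective : S → Set a
  bijective x = injective x × surjective x
    where open import Data.Product using (_×_)

  vector : S → Set a
  vector x = x · ⊤ᵣ ≡ x

  -- array update of x at index y to value z
  update : S → S → S → S
  update x y z = (y ⊓ (z ᵀ)) ⊔ ((‾ y) ⊓ x)

{-# OPTIONS --safe #-}
-- The update is a case distinction along the vector y, taking zᵀ on y and x
-- on ‾ y. Its univalence reduces to that of the two branches because the cross
-- terms lie below yᵀ · ‾ y or its transpose, and yᵀ · ‾ y = ⊥ for a vector. For
-- totality, 𝟙 splits as (𝟙 ⊓ y) ⊔ (𝟙 ⊓ ‾ y), and the Dedekind rule restricts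
-- the totality of each branch to the part of 𝟙 on which it is selected.
module Submission where

open import Defs
open import Level using (Level)
open import Data.Product using (_,_)
open import Relation.Binary.Bundles using (Poset)
open import Relation.Binary.PropositionalEquality
  using (_≡_; refl; sym; trans; cong; cong₂; subst₂; isEquivalence)
import Relation.Binary.Reasoning.PartialOrder as PosetReasoning

module KleeneRelationAlgebraProperties {a : Level} (K : KleeneRelationAlgebra a) where
  open KleeneRelationAlgebra K

  ⊑-reflexive : ∀ {x y} → x ≡ y → x ⊑ y
  ⊑-reflexive {x} refl = ⊔-idem x

  ⊑-trans : ∀ {x y z} → x ⊑ y → y ⊑ z → x ⊑ z
  ⊑-trans {x} {y} {z} x⊑y y⊑z =
    trans (cong (x ⊔_) (sym y⊑z))
      (trans (sym (⊔-assoc x y z)) (trans (cong (_⊔ z) x⊑y) y⊑z))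

  ⊑-antisym : ∀ {x y} → x ⊑ y → y ⊑ x → x ≡ y
  ⊑-antisym {x} {y} x⊑y y⊑x = trans (sym y⊑x) (trans (⊔-comm y x) x⊑y)

  ⊑-poset : Poset a a a
  ⊑-poset = record
    { isPartialOrder = record
      { isPreorder = record
        { isEquivalence = isEquivalence
        ; reflexive = ⊑-reflexive
        ; trans = ⊑-trans
        }
      ; antisym = ⊑-antisym
      }
    }

  open PosetReasoning ⊑-poset

  x⊑x⊔y : ∀ x y → x ⊑ x ⊔ y
  x⊑x⊔y x y = trans (sym (⊔-assoc x x y)) (cong (_⊔ y) (⊔-idem x))

  y⊑x⊔y : ∀ x y → y ⊑ x ⊔ y
  y⊑x⊔y x y = trans (cong (y ⊔_) (⊔-comm x y)) (trans (x⊑x⊔y y x) (⊔-comm y x))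

  ⊔-lub : ∀ {x y z} → x ⊑ z → y ⊑ z → x ⊔ y ⊑ z
  ⊔-lub {x} {y} {z} x⊑z y⊑z = trans (⊔-assoc x y z) (trans (cong (x ⊔_) y⊑z) x⊑z)

  ⊔-mono : ∀ {x y u v} → x ⊑ y → u ⊑ v → x ⊔ u ⊑ y ⊔ v
  ⊔-mono {y = y} {v = v} x⊑y u⊑v =
    ⊔-lub (⊑-trans x⊑y (x⊑x⊔y y v)) (⊑-trans u⊑v (y⊑x⊔y y v))

  ⊓⇒⊑ : ∀ {x y} → x ⊓ y ≡ x → x ⊑ y
  ⊓⇒⊑ {x} {y} x⊓y≡x = trans (cong (_⊔ y) (sym x⊓y≡x))
    (trans (⊔-comm (x ⊓ y) y) (trans (cong (y ⊔_) (⊓-comm x y)) (⊔-absorb y x)))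

  ⊑⇒⊓ : ∀ {x y} → x ⊑ y → x ⊓ y ≡ x
  ⊑⇒⊓ {x} {y} x⊑y = trans (cong (x ⊓_) (sym x⊑y)) (⊓-absorb x y)

  x⊓y⊑x : ∀ x y → x ⊓ y ⊑ x
  x⊓y⊑x x y = trans (⊔-comm (x ⊓ y) x) (⊔-absorb x y)

  x⊓y⊑y : ∀ x y → x ⊓ y ⊑ y
  x⊓y⊑y x y = trans (cong (_⊔ y) (⊓-comm x y)) (x⊓y⊑x y x)

  ⊓-glb : ∀ {x y z} → z ⊑ x → z ⊑ y → z ⊑ x ⊓ y
  ⊓-glb {x} {y} {z} z⊑x z⊑y =
    ⊓⇒⊑ (trans (sym (⊓-assoc z x y)) (trans (cong (_⊓ y) (⊑⇒⊓ z⊑x)) (⊑⇒⊓ z⊑y)))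

  ⊓-mono : ∀ {x y u v} → x ⊑ y → u ⊑ v → x ⊓ u ⊑ y ⊓ v
  ⊓-mono {x} {u = u} x⊑y u⊑v =
    ⊓-glb (⊑-trans (x⊓y⊑x x u) x⊑y) (⊑-trans (x⊓y⊑y x u) u⊑v)

  ⊥ᵣ⊑x : ∀ x → ⊥ᵣ ⊑ x
  ⊥ᵣ⊑x x = trans (⊔-comm ⊥ᵣ x) (⊔-identity x)

  x⊑⊤ᵣ : ∀ x → x ⊑ ⊤ᵣ
  x⊑⊤ᵣ x = ⊓⇒⊑ (⊓-identity x)

  ⊓-‾-partition : ∀ x v → x ≡ (x ⊓ v) ⊔ (x ⊓ ‾ v)
  ⊓-‾-partition x v = begin-equality
    x                       ≡⟨ sym (⊓-identity x) ⟩
    x ⊓ ⊤ᵣ                  ≡⟨ cong (x ⊓_) (sym (compl-⊔ v)) ⟩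
    x ⊓ (v ⊔ ‾ v)           ≡⟨ ⊓-distrib-⊔ x v (‾ v) ⟩
    (x ⊓ v) ⊔ (x ⊓ ‾ v)     ∎

  ·-monoˡ : ∀ {x y} z → x ⊑ y → x · z ⊑ y · z
  ·-monoˡ {x} {y} z x⊑y = trans (sym (·-distribʳ z x y)) (cong (_· z) x⊑y)

  ·-monoʳ : ∀ {x y} z → x ⊑ y → z · x ⊑ z · y
  ·-monoʳ {x} {y} z x⊑y = trans (sym (·-distribˡ z x y)) (cong (z ·_) x⊑y)

  ·-mono : ∀ {x y u v} → x ⊑ y → u ⊑ v → x · u ⊑ y · v
  ·-mono {y = y} {u} x⊑y u⊑v = ⊑-trans (·-monoˡ u x⊑y) (·-monoʳ y u⊑v)

  ᵀ-mono : ∀ {x y} → x ⊑ y → x ᵀ ⊑ y ᵀ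
  ᵀ-mono {x} {y} x⊑y = trans (sym (ᵀ-⊔ x y)) (cong _ᵀ x⊑y)

  ᵀ-reflects-⊑ : ∀ {x y} → x ᵀ ⊑ y ᵀ → x ⊑ y
  ᵀ-reflects-⊑ {x} {y} xᵀ⊑yᵀ = subst₂ _⊑_ (ᵀ-invol x) (ᵀ-invol y) (ᵀ-mono xᵀ⊑yᵀ)

  ᵀ-·-mono : ∀ {x y u v} → x ⊑ y → u ⊑ v → x ᵀ · u ⊑ y ᵀ · v
  ᵀ-·-mono x⊑y = ·-mono (ᵀ-mono x⊑y)

  ⊥ᵣᵀ : ⊥ᵣ ᵀ ≡ ⊥ᵣ
  ⊥ᵣᵀ = begin-equality
    ⊥ᵣ ᵀ                ≡⟨ cong _ᵀ (sym (·-zeroˡ (⊥ᵣ ᵀ))) ⟩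
    (⊥ᵣ · ⊥ᵣ ᵀ) ᵀ       ≡⟨ ᵀ-· ⊥ᵣ (⊥ᵣ ᵀ) ⟩
    (⊥ᵣ ᵀ) ᵀ · ⊥ᵣ ᵀ     ≡⟨ cong (_· ⊥ᵣ ᵀ) (ᵀ-invol ⊥ᵣ) ⟩
    ⊥ᵣ · ⊥ᵣ ᵀ           ≡⟨ ·-zeroˡ (⊥ᵣ ᵀ) ⟩
    ⊥ᵣ                  ∎

  ᵀ-⊓-⊑ : ∀ x y → (x ⊓ y) ᵀ ⊑ x ᵀ ⊓ y ᵀ
  ᵀ-⊓-⊑ x y = ⊓-glb (ᵀ-mono (x⊓y⊑x x y)) (ᵀ-mono (x⊓y⊑y x y))

  ᵀ-distrib-⊓ : ∀ x y → (x ⊓ y) ᵀ ≡ x ᵀ ⊓ y ᵀ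
  ᵀ-distrib-⊓ x y = ⊑-antisym (ᵀ-⊓-⊑ x y) (ᵀ-reflects-⊑ (begin
    (x ᵀ ⊓ y ᵀ) ᵀ           ≤⟨ ᵀ-⊓-⊑ (x ᵀ) (y ᵀ) ⟩
    (x ᵀ) ᵀ ⊓ (y ᵀ) ᵀ       ≡⟨ cong₂ _⊓_ (ᵀ-invol x) (ᵀ-invol y) ⟩
    x ⊓ y                   ≡⟨ sym (ᵀ-invol (x ⊓ y)) ⟩
    ((x ⊓ y) ᵀ) ᵀ           ∎))

  ᵀ-·-distrib-⊔ : ∀ x y u v →
    (x ⊔ y) ᵀ · (u ⊔ v) ≡ (x ᵀ · u ⊔ x ᵀ · v) ⊔ (y ᵀ · u ⊔ y ᵀ · v)
  ᵀ-·-distrib-⊔ x y u v = begin-equality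
    (x ⊔ y) ᵀ · (u ⊔ v)                         ≡⟨ cong (_· (u ⊔ v)) (ᵀ-⊔ x y) ⟩
    (x ᵀ ⊔ y ᵀ) · (u ⊔ v)                       ≡⟨ ·-distribʳ (u ⊔ v) (x ᵀ) (y ᵀ) ⟩
    x ᵀ · (u ⊔ v) ⊔ y ᵀ · (u ⊔ v)               ≡⟨ cong₂ _⊔_ (·-distribˡ (x ᵀ) u v) (·-distribˡ (y ᵀ) u v) ⟩
    (x ᵀ · u ⊔ x ᵀ · v) ⊔ (y ᵀ · u ⊔ y ᵀ · v)   ∎

  dedekind′ : ∀ x y z → (x · y) ⊓ z ⊑ (x ⊓ (z · y ᵀ)) · y
  dedekind′ x y z = ᵀ-reflects-⊑ (begin
    ((x · y) ⊓ z) ᵀ                 ≡⟨ ᵀ-distrib-⊓ (x · y) z ⟩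
    (x · y) ᵀ ⊓ z ᵀ                 ≡⟨ cong (_⊓ z ᵀ) (ᵀ-· x y) ⟩
    (y ᵀ · x ᵀ) ⊓ z ᵀ               ≤⟨ dedekind (y ᵀ) (x ᵀ) (z ᵀ) ⟩
    y ᵀ · (x ᵀ ⊓ (y ᵀ) ᵀ · z ᵀ)     ≡⟨ cong (λ t → y ᵀ · (x ᵀ ⊓ t)) (sym (ᵀ-· z (y ᵀ))) ⟩
    y ᵀ · (x ᵀ ⊓ (z · y ᵀ) ᵀ)       ≡⟨ cong (y ᵀ ·_) (sym (ᵀ-distrib-⊓ x (z · y ᵀ))) ⟩
    y ᵀ · (x ⊓ (z · y ᵀ)) ᵀ         ≡⟨ sym (ᵀ-· (x ⊓ (z · y ᵀ)) y) ⟩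
    ((x ⊓ (z · y ᵀ)) · y) ᵀ         ∎)

  vector-·-absorb : ∀ {v} w → vector v → v · w ⊑ v
  vector-·-absorb {v} w v·⊤≡v = ⊑-trans (·-monoʳ v (x⊑⊤ᵣ w)) (⊑-reflexive v·⊤≡v)

  ‾-vector : ∀ {v} → vector v → vector (‾ v)
  ‾-vector {v} v·⊤≡v = ⊑-antisym ‾v·⊤⊑‾v ‾v⊑‾v·⊤
    where
    ‾v⊑‾v·⊤ : ‾ v ⊑ ‾ v · ⊤ᵣ
    ‾v⊑‾v·⊤ = begin
      ‾ v             ≡⟨ sym (·-identityʳ (‾ v)) ⟩
      ‾ v · 𝟙         ≤⟨ ·-monoʳ (‾ v) (x⊑⊤ᵣ 𝟙) ⟩
      ‾ v · ⊤ᵣ        ∎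

    ‾v·⊤⊓v⊑⊥ : (‾ v · ⊤ᵣ) ⊓ v ⊑ ⊥ᵣ
    ‾v·⊤⊓v⊑⊥ = begin
      (‾ v · ⊤ᵣ) ⊓ v              ≤⟨ dedekind′ (‾ v) ⊤ᵣ v ⟩
      (‾ v ⊓ (v · ⊤ᵣ ᵀ)) · ⊤ᵣ     ≤⟨ ·-monoˡ ⊤ᵣ (⊓-mono (⊑-reflexive refl) (vector-·-absorb (⊤ᵣ ᵀ) v·⊤≡v)) ⟩
      (‾ v ⊓ v) · ⊤ᵣ              ≡⟨ cong (_· ⊤ᵣ) (trans (⊓-comm (‾ v) v) (compl-⊓ v)) ⟩
      ⊥ᵣ · ⊤ᵣ                     ≡⟨ ·-zeroˡ ⊤ᵣ ⟩
      ⊥ᵣ                          ∎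

    ‾v·⊤⊑‾v : ‾ v · ⊤ᵣ ⊑ ‾ v
    ‾v·⊤⊑‾v = begin
      ‾ v · ⊤ᵣ                                  ≡⟨ ⊓-‾-partition (‾ v · ⊤ᵣ) v ⟩
      ((‾ v · ⊤ᵣ) ⊓ v) ⊔ ((‾ v · ⊤ᵣ) ⊓ ‾ v)     ≤⟨ ⊔-lub (⊑-trans ‾v·⊤⊓v⊑⊥ (⊥ᵣ⊑x (‾ v))) (x⊓y⊑y _ (‾ v)) ⟩
      ‾ v                                       ∎

  vectorᵀ-·-‾≡⊥ : ∀ {v} → vector v → v ᵀ · ‾ v ≡ ⊥ᵣ
  vectorᵀ-·-‾≡⊥ {v} v·⊤≡v = ⊑-antisym (begin
    v ᵀ · ‾ v                       ≡⟨ sym (⊓-identity (v ᵀ · ‾ v)) ⟩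
    (v ᵀ · ‾ v) ⊓ ⊤ᵣ                ≤⟨ dedekind (v ᵀ) (‾ v) ⊤ᵣ ⟩
    v ᵀ · (‾ v ⊓ (v ᵀ) ᵀ · ⊤ᵣ)      ≡⟨ cong (λ t → v ᵀ · (‾ v ⊓ t)) (trans (cong (_· ⊤ᵣ) (ᵀ-invol v)) v·⊤≡v) ⟩
    v ᵀ · (‾ v ⊓ v)                 ≡⟨ cong (v ᵀ ·_) (trans (⊓-comm (‾ v) v) (compl-⊓ v)) ⟩
    v ᵀ · ⊥ᵣ                        ≡⟨ ·-zeroʳ (v ᵀ) ⟩
    ⊥ᵣ                              ∎) (⊥ᵣ⊑x (v ᵀ · ‾ v))

  ‾vectorᵀ-·-vector≡⊥ : ∀ {v} → vector v → (‾ v) ᵀ · v ≡ ⊥ᵣ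
  ‾vectorᵀ-·-vector≡⊥ {v} v·⊤≡v = begin-equality
    (‾ v) ᵀ · v             ≡⟨ cong ((‾ v) ᵀ ·_) (sym (ᵀ-invol v)) ⟩
    (‾ v) ᵀ · (v ᵀ) ᵀ       ≡⟨ sym (ᵀ-· (v ᵀ) (‾ v)) ⟩
    (v ᵀ · ‾ v) ᵀ           ≡⟨ cong _ᵀ (vectorᵀ-·-‾≡⊥ v·⊤≡v) ⟩
    ⊥ᵣ ᵀ                    ≡⟨ ⊥ᵣᵀ ⟩
    ⊥ᵣ                      ∎

  𝟙⊓vector⊑total-restrict : ∀ {v w} → vector v → total w →
    𝟙 ⊓ v ⊑ (v ⊓ w) · (v ⊓ w) ᵀ
  𝟙⊓vector⊑total-restrict {v} {w} v·⊤≡v 𝟙⊑w·wᵀ = begin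
    𝟙 ⊓ v                                   ≤⟨ ⊓-glb 𝟙⊓v⊑[v⊓w]·wᵀ (x⊓y⊑x 𝟙 v) ⟩
    ((v ⊓ w) · w ᵀ) ⊓ 𝟙                     ≤⟨ dedekind (v ⊓ w) (w ᵀ) 𝟙 ⟩
    (v ⊓ w) · (w ᵀ ⊓ (v ⊓ w) ᵀ · 𝟙)         ≤⟨ ·-monoʳ (v ⊓ w) (x⊓y⊑y (w ᵀ) _) ⟩
    (v ⊓ w) · ((v ⊓ w) ᵀ · 𝟙)               ≡⟨ cong ((v ⊓ w) ·_) (·-identityʳ ((v ⊓ w) ᵀ)) ⟩
    (v ⊓ w) · (v ⊓ w) ᵀ                     ∎
    where
    𝟙⊓v⊑[v⊓w]·wᵀ : 𝟙 ⊓ v ⊑ (v ⊓ w) · w ᵀ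
    𝟙⊓v⊑[v⊓w]·wᵀ = begin
      𝟙 ⊓ v                       ≤⟨ ⊓-mono 𝟙⊑w·wᵀ (⊑-reflexive refl) ⟩
      (w · w ᵀ) ⊓ v               ≤⟨ dedekind′ w (w ᵀ) v ⟩
      (w ⊓ v · (w ᵀ) ᵀ) · w ᵀ     ≤⟨ ·-monoˡ (w ᵀ) (⊓-mono (⊑-reflexive refl) (vector-·-absorb ((w ᵀ) ᵀ) v·⊤≡v)) ⟩
      (w ⊓ v) · w ᵀ               ≡⟨ cong (_· w ᵀ) (⊓-comm w v) ⟩
      (v ⊓ w) · w ᵀ               ∎

  vector-case-univalent : ∀ {v p q} → vector v → univalent p → univalent q →
    univalent ((v ⊓ p) ⊔ (‾ v ⊓ q))
  vector-case-univalent {v} {p} {q} v·⊤≡v pᵀ·p⊑𝟙 qᵀ·q⊑𝟙 = begin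
    (P ⊔ Q) ᵀ · (P ⊔ Q)                         ≡⟨ ᵀ-·-distrib-⊔ P Q P Q ⟩
    (P ᵀ · P ⊔ P ᵀ · Q) ⊔ (Q ᵀ · P ⊔ Q ᵀ · Q)   ≤⟨ ⊔-lub (⊔-lub Pᵀ·P⊑𝟙 Pᵀ·Q⊑𝟙) (⊔-lub Qᵀ·P⊑𝟙 Qᵀ·Q⊑𝟙) ⟩
    𝟙                                           ∎
    where
    P = v ⊓ p
    Q = ‾ v ⊓ q

    Pᵀ·P⊑𝟙 : P ᵀ · P ⊑ 𝟙
    Pᵀ·P⊑𝟙 = ⊑-trans (ᵀ-·-mono (x⊓y⊑y v p) (x⊓y⊑y v p)) pᵀ·p⊑𝟙

    Qᵀ·Q⊑𝟙 : Q ᵀ · Q ⊑ 𝟙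
    Qᵀ·Q⊑𝟙 = ⊑-trans (ᵀ-·-mono (x⊓y⊑y (‾ v) q) (x⊓y⊑y (‾ v) q)) qᵀ·q⊑𝟙

    Pᵀ·Q⊑𝟙 : P ᵀ · Q ⊑ 𝟙
    Pᵀ·Q⊑𝟙 = begin
      P ᵀ · Q       ≤⟨ ᵀ-·-mono (x⊓y⊑x v p) (x⊓y⊑x (‾ v) q) ⟩
      v ᵀ · ‾ v     ≡⟨ vectorᵀ-·-‾≡⊥ v·⊤≡v ⟩
      ⊥ᵣ            ≤⟨ ⊥ᵣ⊑x 𝟙 ⟩
      𝟙             ∎

    Qᵀ·P⊑𝟙 : Q ᵀ · P ⊑ 𝟙
    Qᵀ·P⊑𝟙 = begin
      Q ᵀ · P       ≤⟨ ᵀ-·-mono (x⊓y⊑x (‾ v) q) (x⊓y⊑x v p) ⟩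
      (‾ v) ᵀ · v   ≡⟨ ‾vectorᵀ-·-vector≡⊥ v·⊤≡v ⟩
      ⊥ᵣ            ≤⟨ ⊥ᵣ⊑x 𝟙 ⟩
      𝟙             ∎

  vector-case-total : ∀ {v p q} → vector v → total p → total q →
    total ((v ⊓ p) ⊔ (‾ v ⊓ q))
  vector-case-total {v} {p} {q} v·⊤≡v 𝟙⊑p·pᵀ 𝟙⊑q·qᵀ = begin
    𝟙                           ≡⟨ ⊓-‾-partition 𝟙 v ⟩
    (𝟙 ⊓ v) ⊔ (𝟙 ⊓ ‾ v)         ≤⟨ ⊔-mono (𝟙⊓vector⊑total-restrict v·⊤≡v 𝟙⊑p·pᵀ)
                                          (𝟙⊓vector⊑total-restrict (‾-vector v·⊤≡v) 𝟙⊑q·qᵀ) ⟩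
    P · P ᵀ ⊔ Q · Q ᵀ           ≤⟨ ⊔-lub (·-mono (x⊑x⊔y P Q) (ᵀ-mono (x⊑x⊔y P Q)))
                                         (·-mono (y⊑x⊔y P Q) (ᵀ-mono (y⊑x⊔y P Q))) ⟩
    (P ⊔ Q) · (P ⊔ Q) ᵀ         ∎
    where
    P = v ⊓ p
    Q = ‾ v ⊓ q

  injective⇒ᵀ-univalent : ∀ {z} → injective z → univalent (z ᵀ)
  injective⇒ᵀ-univalent {z} z·zᵀ⊑𝟙 = ⊑-trans (⊑-reflexive (cong (_· z ᵀ) (ᵀ-invol z))) z·zᵀ⊑𝟙

  surjective⇒ᵀ-total : ∀ {z} → surjective z → total (z ᵀ)
  surjective⇒ᵀ-total {z} 𝟙⊑zᵀ·z = ⊑-trans 𝟙⊑zᵀ·z (⊑-reflexive (cong (z ᵀ ·_) (sym (ᵀ-invol z))))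

  update-mapping : ∀ {x y z} → mapping x → vector y → bijective z → mapping (update x y z)
  update-mapping (x-univalent , x-total) y-vector (z-injective , z-surjective) =
    vector-case-univalent y-vector (injective⇒ᵀ-univalent z-injective) x-univalent ,
    vector-case-total y-vector (surjective⇒ᵀ-total z-surjective) x-total

theorem1p3 : {a : Level} (K : KleeneRelationAlgebra a) →
    let open KleeneRelationAlgebra K in
    TarskiRule → ∀ x y z →
    mapping x → vector y → bijective z →
    mapping ((y ⊓ (z ᵀ)) ⊔ ((‾ y) ⊓ x))
theorem1p3 K _ x y z = KleeneRelationAlgebraProperties.update-mapping K
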